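{- For $m\ge1$, the number of non-increasing, graphical, almost-half-regular splitted bipartite degree sequences on $m+m$ vertices is $$2\binom{2m}{m}-m^2-1=O\!\left(\frac{4^m}{\sqrt m}\right).$$ Here zero degrees are allowed.
   Context: A splitted bipartite degree sequence on $m+m$ vertices is a pair $\langle\mathfrak{u},\mathfrak{w}\rangle$ of degree sequences. The sequence $\mathfrak{u}$ gives the degrees of the $m$ primary vertices and $\mathfrak{w}$ gives the degrees of the $m$ secondary vertices of a bipartite graph; which side is primary is part of the data. Both sequences are taken in non-increasing order. It is graphical if a simple bipartite graph realizes it. It is almost-half-regular if, on at least one of the two sides, any two entries differ by at most $1$. -}

module Defs where

open import Data.Nat using (ℕ; _+_; _*_; _∸_; _≤_; _^_)
open import Data.Nat.Combinatorics using (_C_)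
open import Data.Bool using (Bool; true; false; if_then_else_)
open import Data.Fin using (Fin) renaming (_≤_ to _≤ᶠ_)
open import Data.Vec using (Vec; lookup; tabulate; sum)
open import Data.List using (List; length)
open import Data.List.Membership.Propositional using (_∈_)
open import Data.List.Relation.Unary.Unique.Propositional using (Unique)
open import Data.Product using (Σ; ∃; _×_)
open import Data.Sum using (_⊎_)
open import Function.Bundles using (_⇔_)

-- A splitted bipartite degree sequence on m+m vertices:
-- (primary degrees, secondary degrees).
SBDS : ℕ → Set
SBDS m = Vec ℕ m × Vec ℕ m

NonIncreasing : ∀ {m} → Vec ℕ m → Set
NonIncreasing {m} v = (i j : Fin m) → i ≤ᶠ j → lookup v j ≤ lookup v i

BipGraph : ℕ → Set
BipGraph m = Fin m → Fin m → Bool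

toℕ𝔹 : Bool → ℕ
toℕ𝔹 b = if b then 1 else 0

primaryDeg : ∀ {m} → BipGraph m → Fin m → ℕ
primaryDeg {m} G i = sum (tabulate {n = m} λ j → toℕ𝔹 (G i j))

secondaryDeg : ∀ {m} → BipGraph m → Fin m → ℕ
secondaryDeg {m} G j = sum (tabulate {n = m} λ i → toℕ𝔹 (G i j))

Realizes : ∀ {m} → BipGraph m → Vec ℕ m → Vec ℕ m → Set
Realizes {m} G u w =
  ((i : Fin m) → primaryDeg G i ≡ lookup u i) ×
  ((j : Fin m) → secondaryDeg G j ≡ lookup w j)
  where open import Relation.Binary.PropositionalEquality using (_≡_)

Graphical : ∀ {m} → SBDS m → Set
Graphical {m} (u Data.Product., w) = Σ (BipGraph m) λ G → Realizes G u w

AlmostRegular : ∀ {m} → Vec ℕ m → Set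
AlmostRegular {m} v = (i j : Fin m) → lookup v i ≤ lookup v j + 1

AlmostHalfRegular : ∀ {m} → SBDS m → Set
AlmostHalfRegular (u Data.Product., w) = AlmostRegular u ⊎ AlmostRegular w

Counted : ∀ {m} → SBDS m → Set
Counted s@(u Data.Product., w) =
  NonIncreasing u × NonIncreasing w × Graphical s × AlmostHalfRegular s

HasCard : {A : Set} → (A → Set) → ℕ → Set
HasCard {A} P n = Σ (List A) λ L → Unique L × ((x : A) → (x ∈ L) ⇔ P x) × length L ≡ n
  where open import Relation.Binary.PropositionalEquality using (_≡_)

count : ℕ → ℕ
count m = 2 * ((2 * m) C m) ∸ m * m ∸ 1

-- A side whose entries differ by at most one is determined, once sorted, by its sum S: it is the
-- balanced vector with S mod m entries ⌊S/m⌋ + 1 and the others ⌊S/m⌋.  Conversely any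
-- non-increasing w with entries ≤ m is realized together with the balanced vector of the same sum,
-- by dealing out the edges of the secondary vertices cyclically over the primary ones.  Hence the
-- counted pairs are (balanced (sum w), w) and (u, balanced (sum u)) with u, w among the C(2m, m)
-- non-increasing vectors in {0..m}^m, and the two families share exactly the m² + 1 pairs of two
-- balanced vectors.  The growth bound is C(2m, m)² (3m + 1) ≤ 16^m, by induction from
-- (m + 1) C(2m + 2, m + 1) = 2 (2m + 1) C(2m, m).

module Submission where

open import Defs
open import Data.Nat using (ℕ; _*_; _≤_; _^_)
open import Data.Product using (_×_; ∃)

open import Data.Nat as ℕ
  using (zero; suc; _+_; _∸_; _<_; z≤n; s≤s; _%_; _/_; NonZero; >-nonZero)
open import Data.Nat.Properties
open import Data.Nat.DivMod using (m≡m%n+[m/n]*n; [m+n]%n≡m%n; m%n<n; m%n≤n; m<n⇒m%n≡m)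
open import Data.Nat.Combinatorics using (_C_; nCn≡1; nCk+nC[k+1]≡[n+1]C[k+1]; nCk≡nC[n∸k]; nC1≡n)
open import Data.Nat.Solver using (module +-*-Solver)
open import Data.Fin as Fin using (Fin; toℕ)
open import Data.Fin.Properties using (toℕ<n)
open import Data.Vec as Vec using (Vec; []; _∷_; lookup; tabulate; sum)
open import Data.Vec.Properties using (lookup∘tabulate; tabulate∘lookup; ∷-injectiveʳ; ≡-dec)
open import Data.List as List using (List; length; map; filter; _++_; upTo)
open import Data.List.Properties using (length-map; length-++; length-upTo)
open import Data.List.Membership.Propositional using (_∈_)
open import Data.List.Membership.Propositional.Properties
  using (∈-map⁺; ∈-map⁻; ∈-++⁺ˡ; ∈-++⁺ʳ; ∈-++⁻; ∈-upTo⁺; ∈-upTo⁻; ∈-filter⁺; ∈-filter⁻)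
open import Data.List.Membership.Propositional.Properties.WithK using (unique∧set⇒bag)
open import Data.List.Relation.Binary.BagAndSetEquality using (∼bag⇒↭)
open import Data.List.Relation.Binary.Permutation.Propositional.Properties using (↭-length)
open import Data.List.Relation.Unary.Any using (here)
open import Data.List.Relation.Unary.Unique.Propositional using (Unique; []; _∷_)
open import Data.List.Relation.Unary.Unique.Propositional.Properties
  using (map⁺; ++⁺; filter⁺; upTo⁺)
open import Data.List.Relation.Unary.All using ([])
open import Data.Product using (_,_; proj₁; proj₂)
open import Data.Sum as Sum using (inj₁; inj₂)
open import Data.Unit using (⊤; tt)
open import Data.Empty using (⊥-elim)
open import Data.Bool using (Bool; true; false)
open import Function using (_∘_)
open import Function.Bundles using (_⇔_; mk⇔)
open import Relation.Binary.PropositionalEquality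
open import Relation.Binary.Definitions using (tri<; tri≈; tri>)
open import Relation.Nullary using (¬_; Dec; yes; no)
open import Relation.Unary.Properties using (∁?)

open import Algebra.Properties.CommutativeMonoid.Sum +-0-commutativeMonoid
  using (sum-syntax; sum-cong-≗; ∑-distrib-+; ∑-comm)

sum-tabulate : ∀ {n} (f : Fin n → ℕ) → sum (tabulate f) ≡ ∑[ i < n ] f i
sum-tabulate {zero} f = refl
sum-tabulate {suc n} f = cong (f Fin.zero +_) (sum-tabulate (f ∘ Fin.suc))

sum≡∑-lookup : ∀ {n} (v : Vec ℕ n) → sum v ≡ ∑[ i < n ] lookup v i
sum≡∑-lookup v = trans (cong sum (sym (tabulate∘lookup v))) (sum-tabulate (lookup v))

∑-const : ∀ n c → ∑[ i < n ] c ≡ n * c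
∑-const zero c = refl
∑-const (suc n) c = cong (c +_) (∑-const n c)

∑-mono-≤ : ∀ {n} {f g : Fin n → ℕ} → (∀ i → f i ≤ g i) → ∑[ i < n ] f i ≤ ∑[ i < n ] g i
∑-mono-≤ {zero} f≤g = z≤n
∑-mono-≤ {suc n} f≤g = +-mono-≤ (f≤g Fin.zero) (∑-mono-≤ (f≤g ∘ Fin.suc))

δ : ℕ → ℕ → ℕ
δ zero zero = 1
δ zero (suc _) = 0
δ (suc _) zero = 0
δ (suc a) (suc b) = δ a b

δ-refl : ∀ a → δ a a ≡ 1
δ-refl zero = refl
δ-refl (suc a) = δ-refl a

δ-≢ : ∀ {a b} → a ≢ b → δ a b ≡ 0
δ-≢ {zero} {zero} a≢b = ⊥-elim (a≢b refl)
δ-≢ {zero} {suc b} a≢b = refl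
δ-≢ {suc a} {zero} a≢b = refl
δ-≢ {suc a} {suc b} a≢b = δ-≢ (a≢b ∘ cong suc)

δ≤1 : ∀ a b → δ a b ≤ 1
δ≤1 zero zero = ≤-refl
δ≤1 zero (suc b) = z≤n
δ≤1 (suc a) zero = z≤n
δ≤1 (suc a) (suc b) = δ≤1 a b

∑-δ : ∀ {n k} → k < n → ∑[ i < n ] δ k (toℕ i) ≡ 1
∑-δ {suc n} {zero} _ = cong suc (trans (∑-const n 0) (*-zeroʳ n))
∑-δ {suc n} {suc k} (s≤s k<n) = ∑-δ k<n

toℕ𝔹≤1 : ∀ b → toℕ𝔹 b ≤ 1
toℕ𝔹≤1 true = ≤-refl
toℕ𝔹≤1 false = z≤n

positive : ℕ → Bool
positive zero = false
positive (suc _) = true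

toℕ𝔹-positive : ∀ {c} → c ≤ 1 → toℕ𝔹 (positive c) ≡ c
toℕ𝔹-positive {zero} _ = refl
toℕ𝔹-positive {suc zero} _ = refl
toℕ𝔹-positive {suc (suc c)} (s≤s ())

transpose : ∀ {m} → BipGraph m → BipGraph m
transpose G i j = G j i

Realizes-transpose : ∀ {m} {G : BipGraph m} {u w : Vec ℕ m} → Realizes G u w → Realizes (transpose G) w u
Realizes-transpose (primary , secondary) = secondary , primary

primaryDeg≤ : ∀ {m} (G : BipGraph m) i → primaryDeg G i ≤ m
primaryDeg≤ {m} G i = begin
  primaryDeg G i               ≡⟨ sum-tabulate (λ j → toℕ𝔹 (G i j)) ⟩
  ∑[ j < m ] toℕ𝔹 (G i j)      ≤⟨ ∑-mono-≤ (λ j → toℕ𝔹≤1 (G i j)) ⟩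
  ∑[ j < m ] 1                 ≡⟨ trans (∑-const m 1) (*-identityʳ m) ⟩
  m                            ∎
  where open ≤-Reasoning

Realizes⇒sum≡ : ∀ {m} {G : BipGraph m} {u w : Vec ℕ m} → Realizes G u w → sum u ≡ sum w
Realizes⇒sum≡ {m} {G} {u} {w} (primary , secondary) = begin
  sum u                                 ≡⟨ sum≡∑-lookup u ⟩
  ∑[ i < m ] lookup u i                 ≡⟨ sum-cong-≗ (λ i → trans (sym (primary i)) (sum-tabulate (λ j → toℕ𝔹 (G i j)))) ⟩
  ∑[ i < m ] ∑[ j < m ] toℕ𝔹 (G i j)    ≡⟨ ∑-comm (λ i j → toℕ𝔹 (G i j)) ⟩
  ∑[ j < m ] ∑[ i < m ] toℕ𝔹 (G i j)    ≡⟨ sum-cong-≗ (λ j → trans (sym (sum-tabulate (λ i → toℕ𝔹 (G i j)))) (secondary j)) ⟩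
  ∑[ j < m ] lookup w j                 ≡⟨ sum≡∑-lookup w ⟨
  sum w                                 ∎
  where open ≡-Reasoning

Counted-swap : ∀ {m} {u w : Vec ℕ m} → Counted (u , w) → Counted (w , u)
Counted-swap {u = u} {w} (u↓ , w↓ , (G , realizes) , almostRegular) =
  w↓ , u↓ , (transpose G , Realizes-transpose {u = u} {w} realizes) , Sum.swap almostRegular

NonIncreasing≤ : ∀ {n} → ℕ → Vec ℕ n → Set
NonIncreasing≤ k [] = ⊤
NonIncreasing≤ k (a ∷ v) = a ≤ k × NonIncreasing≤ a v

NonIncreasing≤-weaken : ∀ {n k k'} {v : Vec ℕ n} → k ≤ k' → NonIncreasing≤ k v → NonIncreasing≤ k' v
NonIncreasing≤-weaken {v = []} k≤k' _ = tt
NonIncreasing≤-weaken {v = a ∷ v} k≤k' (a≤k , v↓) = ≤-trans a≤k k≤k' , v↓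

NonIncreasing≤⇒lookup≤ : ∀ {n k} {v : Vec ℕ n} → NonIncreasing≤ k v → ∀ i → lookup v i ≤ k
NonIncreasing≤⇒lookup≤ {v = a ∷ v} (a≤k , v↓) Fin.zero = a≤k
NonIncreasing≤⇒lookup≤ {v = a ∷ v} (a≤k , v↓) (Fin.suc i) = ≤-trans (NonIncreasing≤⇒lookup≤ v↓ i) a≤k

NonIncreasing≤⇒NonIncreasing : ∀ {n k} {v : Vec ℕ n} → NonIncreasing≤ k v → NonIncreasing v
NonIncreasing≤⇒NonIncreasing {v = a ∷ v} _ Fin.zero Fin.zero _ = ≤-refl
NonIncreasing≤⇒NonIncreasing {v = a ∷ v} (_ , v↓) Fin.zero (Fin.suc j) _ = NonIncreasing≤⇒lookup≤ v↓ j
NonIncreasing≤⇒NonIncreasing {v = a ∷ v} (_ , v↓) (Fin.suc i) (Fin.suc j) (s≤s i≤j) =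
  NonIncreasing≤⇒NonIncreasing v↓ i j i≤j

NonIncreasing⇒NonIncreasing≤ : ∀ {n k} {v : Vec ℕ n} →
  NonIncreasing v → (∀ i → lookup v i ≤ k) → NonIncreasing≤ k v
NonIncreasing⇒NonIncreasing≤ {v = []} _ _ = tt
NonIncreasing⇒NonIncreasing≤ {v = a ∷ v} v↓ v≤k =
  v≤k Fin.zero ,
  NonIncreasing⇒NonIncreasing≤ (λ i j i≤j → v↓ (Fin.suc i) (Fin.suc j) (s≤s i≤j))
                               (λ i → v↓ Fin.zero (Fin.suc i) z≤n)

NonIncreasing≤⇒sum≤ : ∀ {n k} {v : Vec ℕ n} → NonIncreasing≤ k v → sum v ≤ n * k
NonIncreasing≤⇒sum≤ {n} {k} {v} v↓ = begin
  sum v                   ≡⟨ sum≡∑-lookup v ⟩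
  ∑[ i < n ] lookup v i   ≤⟨ ∑-mono-≤ (NonIncreasing≤⇒lookup≤ v↓) ⟩
  ∑[ i < n ] k            ≡⟨ ∑-const n k ⟩
  n * k                   ∎
  where open ≤-Reasoning

nC0≡1 : ∀ n → n C 0 ≡ 1
nC0≡1 n = trans (nCk≡nC[n∸k] {0} {n} z≤n) (nCn≡1 n)

-- Split on whether the head equals k: this is Pascal's rule for (n + k) C n.
nonIncreasingVecs : (n k : ℕ) → List (Vec ℕ n)
nonIncreasingVecs zero k = [] List.∷ List.[]
nonIncreasingVecs (suc n) zero = map (0 ∷_) (nonIncreasingVecs n 0)
nonIncreasingVecs (suc n) (suc k) =
  map (suc k ∷_) (nonIncreasingVecs n (suc k)) ++ nonIncreasingVecs (suc n) k

∈-nonIncreasingVecs⁻ : ∀ n k {v} → v ∈ nonIncreasingVecs n k → NonIncreasing≤ k v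
∈-nonIncreasingVecs⁻ zero k {[]} _ = tt
∈-nonIncreasingVecs⁻ (suc n) zero v∈ with ∈-map⁻ (0 ∷_) v∈
... | w , w∈ , refl = z≤n , ∈-nonIncreasingVecs⁻ n 0 w∈
∈-nonIncreasingVecs⁻ (suc n) (suc k) v∈ with ∈-++⁻ (map (suc k ∷_) (nonIncreasingVecs n (suc k))) v∈
... | inj₂ v∈′ = NonIncreasing≤-weaken (n≤1+n k) (∈-nonIncreasingVecs⁻ (suc n) k v∈′)
... | inj₁ v∈′ with ∈-map⁻ (suc k ∷_) v∈′
...   | w , w∈ , refl = ≤-refl , ∈-nonIncreasingVecs⁻ n (suc k) w∈

∈-nonIncreasingVecs⁺ : ∀ n k {v} → NonIncreasing≤ k v → v ∈ nonIncreasingVecs n k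
∈-nonIncreasingVecs⁺ zero k {[]} _ = here refl
∈-nonIncreasingVecs⁺ (suc n) zero {.0 ∷ v} (z≤n , v↓) = ∈-map⁺ (0 ∷_) (∈-nonIncreasingVecs⁺ n 0 v↓)
∈-nonIncreasingVecs⁺ (suc n) (suc k) {a ∷ v} (a≤1+k , v↓) with m≤n⇒m<n∨m≡n a≤1+k
... | inj₂ refl = ∈-++⁺ˡ (∈-map⁺ (suc k ∷_) (∈-nonIncreasingVecs⁺ n (suc k) v↓))
... | inj₁ (s≤s a≤k) =
  ∈-++⁺ʳ (map (suc k ∷_) (nonIncreasingVecs n (suc k))) (∈-nonIncreasingVecs⁺ (suc n) k (a≤k , v↓))

nonIncreasingVecs-unique : ∀ n k → Unique (nonIncreasingVecs n k)
nonIncreasingVecs-unique zero k = [] ∷ []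
nonIncreasingVecs-unique (suc n) zero = map⁺ ∷-injectiveʳ (nonIncreasingVecs-unique n 0)
nonIncreasingVecs-unique (suc n) (suc k) =
  ++⁺ (map⁺ ∷-injectiveʳ (nonIncreasingVecs-unique n (suc k))) (nonIncreasingVecs-unique (suc n) k) disjoint
  where
  disjoint : ∀ {v} → ¬ (v ∈ map (suc k ∷_) (nonIncreasingVecs n (suc k)) × v ∈ nonIncreasingVecs (suc n) k)
  disjoint (v∈ˡ , v∈ʳ) with ∈-map⁻ (suc k ∷_) v∈ˡ
  ... | w , _ , refl = 1+n≰n (proj₁ (∈-nonIncreasingVecs⁻ (suc n) k v∈ʳ))

length-nonIncreasingVecs : ∀ n k → length (nonIncreasingVecs n k) ≡ (n + k) C n
length-nonIncreasingVecs zero k = sym (nC0≡1 k)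
length-nonIncreasingVecs (suc n) zero = begin
  length (map (0 ∷_) (nonIncreasingVecs n 0)) ≡⟨ length-map (0 ∷_) (nonIncreasingVecs n 0) ⟩
  length (nonIncreasingVecs n 0)              ≡⟨ length-nonIncreasingVecs n 0 ⟩
  (n + 0) C n                                 ≡⟨ cong (_C n) (+-identityʳ n) ⟩
  n C n                                       ≡⟨ trans (nCn≡1 n) (sym (nCn≡1 (suc n))) ⟩
  suc n C suc n                               ≡⟨ cong (_C suc n) (+-identityʳ (suc n)) ⟨
  (suc n + 0) C suc n                         ∎
  where open ≡-Reasoning
length-nonIncreasingVecs (suc n) (suc k) = begin
  length (map (suc k ∷_) (nonIncreasingVecs n (suc k)) ++ nonIncreasingVecs (suc n) k)
    ≡⟨ length-++ (map (suc k ∷_) (nonIncreasingVecs n (suc k))) ⟩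
  length (map (suc k ∷_) (nonIncreasingVecs n (suc k))) + length (nonIncreasingVecs (suc n) k)
    ≡⟨ cong₂ _+_ (trans (length-map _ (nonIncreasingVecs n (suc k))) (length-nonIncreasingVecs n (suc k)))
                 (length-nonIncreasingVecs (suc n) k) ⟩
  (n + suc k) C n + (suc n + k) C suc n
    ≡⟨ cong (λ z → (n + suc k) C n + z C suc n) (sym (+-suc n k)) ⟩
  (n + suc k) C n + (n + suc k) C suc n
    ≡⟨ nCk+nC[k+1]≡[n+1]C[k+1] (n + suc k) n ⟩
  suc (n + suc k) C suc n
    ∎
  where open ≡-Reasoning

AlmostRegular-tail : ∀ {n a} {v : Vec ℕ n} → AlmostRegular (a ∷ v) → AlmostRegular v
AlmostRegular-tail almostRegular i j = almostRegular (Fin.suc i) (Fin.suc j)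

-- Entries of u are ≤ x ≤ y ∸ 1, and almost regularity makes every entry of v at least y ∸ 1.
<-head⇒sum< : ∀ {n x y} {u v : Vec ℕ n} → NonIncreasing≤ x u → AlmostRegular (y ∷ v) → x < y →
              x + sum u < y + sum v
<-head⇒sum< {n} {x} {y} {u} {v} u↓ almostRegular x<y = +-mono-<-≤ x<y (begin
  sum u                  ≡⟨ sum≡∑-lookup u ⟩
  ∑[ i < n ] lookup u i  ≤⟨ ∑-mono-≤ (λ i → ≤-trans (NonIncreasing≤⇒lookup≤ u↓ i) (x≤v i)) ⟩
  ∑[ i < n ] lookup v i  ≡⟨ sum≡∑-lookup v ⟨
  sum v                  ∎)
  where
  open ≤-Reasoning
  x≤v : ∀ i → x ≤ lookup v i
  x≤v i = ≤-pred (≤-trans x<y (≤-trans (almostRegular Fin.zero (Fin.suc i)) (≤-reflexive (+-comm _ 1))))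

almostRegular-unique : ∀ {n a b} {u v : Vec ℕ n} → NonIncreasing≤ a u → NonIncreasing≤ b v →
  AlmostRegular u → AlmostRegular v → sum u ≡ sum v → u ≡ v
almostRegular-unique {u = []} {[]} _ _ _ _ _ = refl
almostRegular-unique {u = x ∷ u} {y ∷ v} (_ , u↓) (_ , v↓) u~ v~ sum≡ with <-cmp x y
... | tri< x<y _ _ = ⊥-elim (<⇒≢ (<-head⇒sum< u↓ v~ x<y) sum≡)
... | tri> _ _ y<x = ⊥-elim (<⇒≢ (<-head⇒sum< v↓ u~ y<x) (sym sum≡))
... | tri≈ _ refl _ =
  cong (x ∷_) (almostRegular-unique u↓ v↓ (AlmostRegular-tail u~) (AlmostRegular-tail v~) (+-cancelˡ-≡ x _ _ sum≡))

-- Position t = 0, 1, 2, … of a line belongs to primary vertex t mod m, and secondary vertex j is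
-- joined to the owners of the next w_j positions.  As w_j ≤ m these owners are distinct, and each
-- primary vertex owns ⌊S/m⌋ or ⌊S/m⌋ + 1 of the first S positions.
module CyclicFilling (m : ℕ) .{{_ : NonZero m}} where

  hit : Fin m → ℕ → ℕ
  hit i t = δ (t % m) (toℕ i)

  visits : Fin m → ℕ → ℕ → ℕ
  visits i a zero = 0
  visits i a (suc l) = hit i a + visits i (suc a) l

  visits-+ : ∀ i a l l′ → visits i a (l + l′) ≡ visits i a l + visits i (a + l) l′
  visits-+ i a zero l′ = cong (λ b → visits i b l′) (sym (+-identityʳ a))
  visits-+ i a (suc l) l′ = begin
    hit i a + visits i (suc a) (l + l′)                          ≡⟨ cong (hit i a +_) (visits-+ i (suc a) l l′) ⟩
    hit i a + (visits i (suc a) l + visits i (suc a + l) l′)     ≡⟨ sym (+-assoc (hit i a) _ _) ⟩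
    visits i a (suc l) + visits i (suc a + l) l′                 ≡⟨ cong (λ b → visits i a (suc l) + visits i b l′) (sym (+-suc a l)) ⟩
    visits i a (suc l) + visits i (a + suc l) l′                 ∎
    where open ≡-Reasoning

  visits-snoc : ∀ i a l → visits i a (suc l) ≡ visits i a l + hit i (a + l)
  visits-snoc i a l = begin
    visits i a (suc l)                  ≡⟨ cong (visits i a) (+-comm 1 l) ⟩
    visits i a (l + 1)                  ≡⟨ visits-+ i a l 1 ⟩
    visits i a l + (hit i (a + l) + 0)  ≡⟨ cong (visits i a l +_) (+-identityʳ _) ⟩
    visits i a l + hit i (a + l)        ∎
    where open ≡-Reasoning

  visits-mono-≤ : ∀ i a {l l′} → l ≤ l′ → visits i a l ≤ visits i a l′
  visits-mono-≤ i a {l} {l′} l≤l′ = begin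
    visits i a l                                 ≤⟨ m≤m+n _ _ ⟩
    visits i a l + visits i (a + l) (l′ ∸ l)     ≡⟨ visits-+ i a l (l′ ∸ l) ⟨
    visits i a (l + (l′ ∸ l))                    ≡⟨ cong (visits i a) (m+[n∸m]≡n l≤l′) ⟩
    visits i a l′                                ∎
    where open ≤-Reasoning

  visits≤ : ∀ i a l → visits i a l ≤ l
  visits≤ i a zero = z≤n
  visits≤ i a (suc l) = +-mono-≤ (δ≤1 (a % m) (toℕ i)) (visits≤ i (suc a) l)

  hit-< : ∀ i {t} → t < m → hit i t ≡ δ t (toℕ i)
  hit-< i t<m = cong (λ r → δ r (toℕ i)) (m<n⇒m%n≡m t<m)

  visits-initial≥ : ∀ i {r} → r ≤ toℕ i → visits i 0 r ≡ 0
  visits-initial≥ i {zero} _ = refl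
  visits-initial≥ i {suc r} r<i = begin
    visits i 0 (suc r)           ≡⟨ visits-snoc i 0 r ⟩
    visits i 0 r + hit i r       ≡⟨ cong₂ _+_ (visits-initial≥ i (<⇒≤ r<i)) (hit-< i (<-≤-trans r<i (<⇒≤ (toℕ<n i)))) ⟩
    δ r (toℕ i)                  ≡⟨ δ-≢ (<⇒≢ r<i) ⟩
    0                            ∎
    where open ≡-Reasoning

  visits-initial< : ∀ i {r} → toℕ i < r → r ≤ m → visits i 0 r ≡ 1
  visits-initial< i {suc r} (s≤s i≤r) r<m with m≤n⇒m<n∨m≡n i≤r
  ... | inj₁ i<r = begin
    visits i 0 (suc r)           ≡⟨ visits-snoc i 0 r ⟩
    visits i 0 r + hit i r       ≡⟨ cong₂ _+_ (visits-initial< i i<r (<⇒≤ r<m)) (hit-< i r<m) ⟩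
    1 + δ r (toℕ i)              ≡⟨ cong (1 +_) (δ-≢ (≢-sym (<⇒≢ i<r))) ⟩
    1                            ∎
    where open ≡-Reasoning
  ... | inj₂ refl = begin
    visits i 0 (suc r)           ≡⟨ visits-snoc i 0 r ⟩
    visits i 0 r + hit i r       ≡⟨ cong₂ _+_ (visits-initial≥ i ≤-refl) (hit-< i r<m) ⟩
    δ r r                        ≡⟨ δ-refl r ⟩
    1                            ∎
    where open ≡-Reasoning

  visits-initial-antitone : ∀ {i j r} → toℕ i ≤ toℕ j → r ≤ m → visits j 0 r ≤ visits i 0 r
  visits-initial-antitone {i} {j} {r} i≤j r≤m with toℕ j ℕ.<? r
  ... | yes j<r = ≤-reflexive (trans (visits-initial< j j<r r≤m) (sym (visits-initial< i (≤-<-trans i≤j j<r) r≤m)))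
  ... | no j≮r = ≤-trans (≤-reflexive (visits-initial≥ j (≮⇒≥ j≮r))) z≤n

  visits-period : ∀ i a → visits i a m ≡ 1
  visits-period i zero = visits-initial< i (toℕ<n i) ≤-refl
  visits-period i (suc a) = +-cancelˡ-≡ (hit i a) _ _ (begin
    hit i a + visits i (suc a) m   ≡⟨⟩
    visits i a (suc m)             ≡⟨ visits-snoc i a m ⟩
    visits i a m + hit i (a + m)   ≡⟨ cong₂ _+_ (visits-period i a) (cong (λ r → δ r (toℕ i)) ([m+n]%n≡m%n a m)) ⟩
    1 + hit i a                    ≡⟨ +-comm 1 (hit i a) ⟩
    hit i a + 1                    ∎)
    where open ≡-Reasoning

  visits-periods : ∀ i a q → visits i a (q * m) ≡ q
  visits-periods i a zero = refl
  visits-periods i a (suc q) =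
    trans (visits-+ i a m (q * m)) (cong₂ _+_ (visits-period i a) (visits-periods i (a + m) q))

  visits≤1 : ∀ i a {l} → l ≤ m → visits i a l ≤ 1
  visits≤1 i a l≤m = ≤-trans (visits-mono-≤ i a l≤m) (≤-reflexive (visits-period i a))

  ∑-visits : ∀ a l → ∑[ i < m ] visits i a l ≡ l
  ∑-visits a zero = trans (∑-const m 0) (*-zeroʳ m)
  ∑-visits a (suc l) = begin
    ∑[ i < m ] (hit i a + visits i (suc a) l)                   ≡⟨ ∑-distrib-+ (λ i → hit i a) (λ i → visits i (suc a) l) ⟩
    ∑[ i < m ] hit i a + ∑[ i < m ] visits i (suc a) l          ≡⟨ cong₂ _+_ (∑-δ (m%n<n a m)) (∑-visits (suc a) l) ⟩
    suc l                                                       ∎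
    where open ≡-Reasoning

  balanced : ℕ → Vec ℕ m
  balanced S = tabulate λ i → visits i 0 S

  lookup-balanced : ∀ S i → lookup (balanced S) i ≡ visits i 0 (S % m) + S / m
  lookup-balanced S i = begin
    lookup (balanced S) i                                  ≡⟨ lookup∘tabulate (λ i → visits i 0 S) i ⟩
    visits i 0 S                                           ≡⟨ cong (visits i 0) (m≡m%n+[m/n]*n S m) ⟩
    visits i 0 (S % m + S / m * m)                         ≡⟨ visits-+ i 0 (S % m) (S / m * m) ⟩
    visits i 0 (S % m) + visits i (S % m) (S / m * m)      ≡⟨ cong (visits i 0 (S % m) +_) (visits-periods i (S % m) (S / m)) ⟩
    visits i 0 (S % m) + S / m                             ∎
    where open ≡-Reasoning

  sum-balanced : ∀ S → sum (balanced S) ≡ S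
  sum-balanced S = trans (sum-tabulate (λ i → visits i 0 S)) (∑-visits 0 S)

  balanced-nonIncreasing : ∀ S → NonIncreasing (balanced S)
  balanced-nonIncreasing S i j i≤j rewrite lookup-balanced S i | lookup-balanced S j =
    +-monoˡ-≤ (S / m) (visits-initial-antitone i≤j (m%n≤n S m))

  balanced-almostRegular : ∀ S → AlmostRegular (balanced S)
  balanced-almostRegular S i j rewrite lookup-balanced S i | lookup-balanced S j = begin
    visits i 0 (S % m) + S / m       ≤⟨ +-monoˡ-≤ (S / m) (visits≤1 i 0 (m%n≤n S m)) ⟩
    1 + S / m                        ≡⟨ +-comm 1 (S / m) ⟩
    S / m + 1                        ≤⟨ +-monoˡ-≤ 1 (m≤n+m (S / m) _) ⟩
    visits j 0 (S % m) + S / m + 1   ∎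
    where open ≤-Reasoning

  balanced-≤ : ∀ {S k} → S ≤ k * m → ∀ i → lookup (balanced S) i ≤ k
  balanced-≤ {S} {k} S≤km i = begin
    lookup (balanced S) i   ≡⟨ lookup∘tabulate (λ i → visits i 0 S) i ⟩
    visits i 0 S            ≤⟨ visits-mono-≤ i 0 S≤km ⟩
    visits i 0 (k * m)      ≡⟨ visits-periods i 0 k ⟩
    k                       ∎
    where open ≤-Reasoning

  balanced-NonIncreasing≤ : ∀ S → NonIncreasing≤ S (balanced S)
  balanced-NonIncreasing≤ S = NonIncreasing⇒NonIncreasing≤ (balanced-nonIncreasing S)
    (λ i → subst (_≤ S) (sym (lookup∘tabulate (λ i → visits i 0 S) i)) (visits≤ i 0 S))

  almostRegular⇒balanced : ∀ {k} {u : Vec ℕ m} → NonIncreasing≤ k u → AlmostRegular u → u ≡ balanced (sum u)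
  almostRegular⇒balanced {u = u} u↓ u~ =
    almostRegular-unique u↓ (balanced-NonIncreasing≤ (sum u)) u~ (balanced-almostRegular (sum u)) (sym (sum-balanced (sum u)))

  offset : ∀ {k} → ℕ → Vec ℕ k → Fin k → ℕ
  offset a (x ∷ w) Fin.zero = a
  offset a (x ∷ w) (Fin.suc j) = offset (a + x) w j

  ∑-visits-blocks : ∀ {k} i a (w : Vec ℕ k) →
    ∑[ j < k ] visits i (offset a w j) (lookup w j) ≡ visits i a (sum w)
  ∑-visits-blocks i a [] = refl
  ∑-visits-blocks i a (x ∷ w) =
    trans (cong (visits i a x +_) (∑-visits-blocks i (a + x) w)) (sym (visits-+ i a x (sum w)))

  filling : Vec ℕ m → BipGraph m
  filling w i j = positive (visits i (offset 0 w j) (lookup w j))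

  filling-realizes : ∀ (w : Vec ℕ m) → (∀ j → lookup w j ≤ m) → Realizes (filling w) (balanced (sum w)) w
  filling-realizes w w≤m = primary , secondary
    where
    edge : ∀ i j → toℕ𝔹 (filling w i j) ≡ visits i (offset 0 w j) (lookup w j)
    edge i j = toℕ𝔹-positive (visits≤1 i (offset 0 w j) (w≤m j))
    primary : ∀ i → primaryDeg (filling w) i ≡ lookup (balanced (sum w)) i
    primary i = begin
      primaryDeg (filling w) i                              ≡⟨ sum-tabulate (λ j → toℕ𝔹 (filling w i j)) ⟩
      ∑[ j < m ] toℕ𝔹 (filling w i j)                       ≡⟨ sum-cong-≗ (edge i) ⟩
      ∑[ j < m ] visits i (offset 0 w j) (lookup w j)       ≡⟨ ∑-visits-blocks i 0 w ⟩
      visits i 0 (sum w)                                    ≡⟨ lookup∘tabulate (λ i → visits i 0 (sum w)) i ⟨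
      lookup (balanced (sum w)) i                           ∎
      where open ≡-Reasoning
    secondary : ∀ j → secondaryDeg (filling w) j ≡ lookup w j
    secondary j = begin
      secondaryDeg (filling w) j                            ≡⟨ sum-tabulate (λ i → toℕ𝔹 (filling w i j)) ⟩
      ∑[ i < m ] toℕ𝔹 (filling w i j)                       ≡⟨ sum-cong-≗ (λ i → edge i j) ⟩
      ∑[ i < m ] visits i (offset 0 w j) (lookup w j)       ≡⟨ ∑-visits (offset 0 w j) (lookup w j) ⟩
      lookup w j                                            ∎
      where open ≡-Reasoning

length-filter+length-filter-∁ : ∀ {A : Set} {P : A → Set} (P? : ∀ x → Dec (P x)) xs →
  length (filter P? xs) + length (filter (∁? P?) xs) ≡ length xs
length-filter+length-filter-∁ P? List.[] = refl
length-filter+length-filter-∁ P? (x List.∷ xs) with P? x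
... | yes _ = cong suc (length-filter+length-filter-∁ P? xs)
... | no _ = trans (+-suc _ _) (cong suc (length-filter+length-filter-∁ P? xs))

unique-sameMembers⇒length≡ : ∀ {A : Set} {xs ys : List A} → Unique xs → Unique ys →
  (∀ {x} → x ∈ xs ⇔ x ∈ ys) → length xs ≡ length ys
unique-sameMembers⇒length≡ xs! ys! same = ↭-length (∼bag⇒↭ (unique∧set⇒bag xs! ys! same))

module _ (m : ℕ) .{{_ : NonZero m}} where

  open CyclicFilling m

  IsBalanced : Vec ℕ m → Set
  IsBalanced u = u ≡ balanced (sum u)

  isBalanced? : ∀ u → Dec (IsBalanced u)
  isBalanced? u = ≡-dec ℕ._≟_ u (balanced (sum u))

  balanced-isBalanced : ∀ S → IsBalanced (balanced S)
  balanced-isBalanced S = cong balanced (sym (sum-balanced S))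

  degreeVecs : List (Vec ℕ m)
  degreeVecs = nonIncreasingVecs m m

  Realizes⇒∈degreeVecs : ∀ {G} {u w : Vec ℕ m} → Realizes G u w → NonIncreasing u → u ∈ degreeVecs
  Realizes⇒∈degreeVecs {G} (primary , _) u↓ =
    ∈-nonIncreasingVecs⁺ m m (NonIncreasing⇒NonIncreasing≤ u↓ (λ i → subst (_≤ m) (primary i) (primaryDeg≤ G i)))

  withBalancedPrimary : Vec ℕ m → SBDS m
  withBalancedPrimary w = balanced (sum w) , w

  withBalancedSecondary : Vec ℕ m → SBDS m
  withBalancedSecondary u = u , balanced (sum u)

  primaryBalancedPairs : List (SBDS m)
  primaryBalancedPairs = map withBalancedPrimary degreeVecs

  onlySecondaryBalancedPairs : List (SBDS m)
  onlySecondaryBalancedPairs = map withBalancedSecondary (filter (∁? isBalanced?) degreeVecs)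

  countedPairs : List (SBDS m)
  countedPairs = primaryBalancedPairs ++ onlySecondaryBalancedPairs

  Counted-withBalancedPrimary : ∀ {w} → w ∈ degreeVecs → Counted (withBalancedPrimary w)
  Counted-withBalancedPrimary {w} w∈ =
    balanced-nonIncreasing (sum w) ,
    NonIncreasing≤⇒NonIncreasing w↓ ,
    (filling w , filling-realizes w (NonIncreasing≤⇒lookup≤ w↓)) ,
    inj₁ (balanced-almostRegular (sum w))
    where w↓ = ∈-nonIncreasingVecs⁻ m m w∈

  ∈countedPairs⇒Counted : ∀ {x} → x ∈ countedPairs → Counted x
  ∈countedPairs⇒Counted x∈ with ∈-++⁻ primaryBalancedPairs x∈
  ... | inj₁ x∈ˡ with ∈-map⁻ withBalancedPrimary x∈ˡ
  ...   | w , w∈ , refl = Counted-withBalancedPrimary w∈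
  ∈countedPairs⇒Counted x∈ | inj₂ x∈ʳ with ∈-map⁻ withBalancedSecondary x∈ʳ
  ...   | u , u∈ , refl =
    Counted-swap {u = balanced (sum u)} {u} (Counted-withBalancedPrimary (proj₁ (∈-filter⁻ (∁? isBalanced?) u∈)))

  Counted⇒∈countedPairs : ∀ {x} → Counted x → x ∈ countedPairs
  Counted⇒∈countedPairs {u , w} (u↓ , w↓ , (G , realizes) , almostHalfRegular) = by almostHalfRegular
    where
    u∈ = Realizes⇒∈degreeVecs {u = u} {w} realizes u↓
    w∈ = Realizes⇒∈degreeVecs {u = w} {u} (Realizes-transpose {u = u} {w} realizes) w↓
    sum≡ : sum u ≡ sum w
    sum≡ = Realizes⇒sum≡ {u = u} {w} realizes
    viaPrimary : IsBalanced u → (u , w) ∈ countedPairs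
    viaPrimary u≡ = subst (λ v → (v , w) ∈ countedPairs) (sym (trans u≡ (cong balanced sum≡)))
                          (∈-++⁺ˡ (∈-map⁺ withBalancedPrimary w∈))
    by : AlmostHalfRegular (u , w) → (u , w) ∈ countedPairs
    by (inj₁ u~) = viaPrimary (almostRegular⇒balanced (∈-nonIncreasingVecs⁻ m m u∈) u~)
    by (inj₂ w~) with isBalanced? u
    ... | yes u≡ = viaPrimary u≡
    ... | no u≢ = subst (λ v → (u , v) ∈ countedPairs) (sym w≡)
                        (∈-++⁺ʳ primaryBalancedPairs (∈-map⁺ withBalancedSecondary (∈-filter⁺ (∁? isBalanced?) u∈ u≢)))
      where
      w≡ : w ≡ balanced (sum u)
      w≡ = trans (almostRegular⇒balanced (∈-nonIncreasingVecs⁻ m m w∈) w~) (cong balanced (sym sum≡))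

  countedPairs-unique : Unique countedPairs
  countedPairs-unique =
    ++⁺ (map⁺ (cong proj₂) (nonIncreasingVecs-unique m m))
        (map⁺ (cong proj₁) (filter⁺ (∁? isBalanced?) (nonIncreasingVecs-unique m m)))
        disjoint
    where
    disjoint : ∀ {x} → ¬ (x ∈ primaryBalancedPairs × x ∈ onlySecondaryBalancedPairs)
    disjoint (x∈ˡ , x∈ʳ) with ∈-map⁻ withBalancedPrimary x∈ˡ | ∈-map⁻ withBalancedSecondary x∈ʳ
    ... | w , _ , refl | u , u∈ , eq =
      proj₂ (∈-filter⁻ (∁? isBalanced?) {xs = degreeVecs} u∈)
            (subst IsBalanced (cong proj₁ eq) (balanced-isBalanced (sum w)))

  length-balancedDegreeVecs : length (filter isBalanced? degreeVecs) ≡ suc (m * m)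
  length-balancedDegreeVecs = begin
    length (filter isBalanced? degreeVecs)
      ≡⟨ unique-sameMembers⇒length≡ (filter⁺ isBalanced? (nonIncreasingVecs-unique m m))
                                    (map⁺ balanced-injective (upTo⁺ (suc (m * m))))
                                    (mk⇔ to from) ⟩
    length (map balanced (upTo (suc (m * m))))
      ≡⟨ trans (length-map balanced (upTo (suc (m * m)))) (length-upTo (suc (m * m))) ⟩
    suc (m * m)
      ∎
    where
    open ≡-Reasoning
    balanced-injective : ∀ {S S′} → balanced S ≡ balanced S′ → S ≡ S′
    balanced-injective {S} {S′} eq = trans (sym (sum-balanced S)) (trans (cong sum eq) (sum-balanced S′))
    to : ∀ {u} → u ∈ filter isBalanced? degreeVecs → u ∈ map balanced (upTo (suc (m * m)))
    to {u} u∈ with ∈-filter⁻ isBalanced? {xs = degreeVecs} u∈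
    ... | u∈′ , u≡ = subst (_∈ map balanced (upTo (suc (m * m)))) (sym u≡)
                           (∈-map⁺ balanced (∈-upTo⁺ (s≤s (NonIncreasing≤⇒sum≤ (∈-nonIncreasingVecs⁻ m m u∈′)))))
    from : ∀ {u} → u ∈ map balanced (upTo (suc (m * m))) → u ∈ filter isBalanced? degreeVecs
    from u∈ with ∈-map⁻ balanced u∈
    ... | S , S∈ , refl = ∈-filter⁺ isBalanced?
      (∈-nonIncreasingVecs⁺ m m (NonIncreasing⇒NonIncreasing≤ (balanced-nonIncreasing S)
                                                             (balanced-≤ (≤-pred (∈-upTo⁻ S∈)))))
      (balanced-isBalanced S)

  length-countedPairs : length countedPairs ≡ count m
  length-countedPairs = begin
    length countedPairs
      ≡⟨ length-++ primaryBalancedPairs ⟩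
    length primaryBalancedPairs + length onlySecondaryBalancedPairs
      ≡⟨ cong₂ _+_ (length-map withBalancedPrimary degreeVecs)
                   (length-map withBalancedSecondary (filter (∁? isBalanced?) degreeVecs)) ⟩
    length degreeVecs + length (filter (∁? isBalanced?) degreeVecs)
      ≡⟨ +-∸-complement (length-filter+length-filter-∁ isBalanced? degreeVecs) ⟩
    2 * length degreeVecs ∸ length (filter isBalanced? degreeVecs)
      ≡⟨ cong₂ (λ a b → 2 * a ∸ b) (length-nonIncreasingVecs m m) length-balancedDegreeVecs ⟩
    2 * ((m + m) C m) ∸ suc (m * m)
      ≡⟨ cong (λ a → 2 * (a C m) ∸ suc (m * m)) (cong (m +_) (sym (+-identityʳ m))) ⟩
    2 * ((2 * m) C m) ∸ suc (m * m)
      ≡⟨ cong (2 * ((2 * m) C m) ∸_) (+-comm 1 (m * m)) ⟩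
    2 * ((2 * m) C m) ∸ (m * m + 1)
      ≡⟨ ∸-+-assoc (2 * ((2 * m) C m)) (m * m) 1 ⟨
    count m
      ∎
    where
    open ≡-Reasoning
    +-∸-complement : ∀ {a b c} → a + b ≡ c → c + b ≡ 2 * c ∸ a
    +-∸-complement {a} {b} {c} a+b≡c = sym (begin
      2 * c ∸ a           ≡⟨ cong (λ d → c + d ∸ a) (trans (+-identityʳ c) (sym a+b≡c)) ⟩
      c + (a + b) ∸ a     ≡⟨ cong (_∸ a) (trans (cong (c +_) (+-comm a b)) (sym (+-assoc c b a))) ⟩
      c + b + a ∸ a       ≡⟨ m+n∸n≡m (c + b) a ⟩
      c + b               ∎)

  counted-HasCard : HasCard (Counted {m}) (count m)
  counted-HasCard = countedPairs , countedPairs-unique , (λ x → mk⇔ ∈countedPairs⇒Counted Counted⇒∈countedPairs) ,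
                    length-countedPairs

[1+k]*[1+n]C[1+k]≡[1+n]*nCk : ∀ n k → suc k * (suc n C suc k) ≡ suc n * (n C k)
[1+k]*[1+n]C[1+k]≡[1+n]*nCk zero zero = refl
[1+k]*[1+n]C[1+k]≡[1+n]*nCk zero (suc k) = *-zeroʳ (suc (suc k))
[1+k]*[1+n]C[1+k]≡[1+n]*nCk (suc n) zero = begin
  1 * (suc (suc n) C 1)        ≡⟨ *-identityˡ _ ⟩
  suc (suc n) C 1              ≡⟨ nC1≡n (suc (suc n)) ⟩
  suc (suc n)                  ≡⟨ *-identityʳ (suc (suc n)) ⟨
  suc (suc n) * 1              ≡⟨ cong (suc (suc n) *_) (nC0≡1 (suc n)) ⟨
  suc (suc n) * (suc n C 0)    ∎
  where open ≡-Reasoning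
[1+k]*[1+n]C[1+k]≡[1+n]*nCk (suc n) (suc k) = begin
  suc (suc k) * (suc (suc n) C suc (suc k))       ≡⟨ cong (suc (suc k) *_) (nCk+nC[k+1]≡[n+1]C[k+1] (suc n) (suc k)) ⟨
  suc (suc k) * (X + Y)                           ≡⟨ regroup k X Y ⟩
  X + (suc k * X + suc (suc k) * Y)               ≡⟨ cong (X +_) (cong₂ _+_ ([1+k]*[1+n]C[1+k]≡[1+n]*nCk n k)
                                                                             ([1+k]*[1+n]C[1+k]≡[1+n]*nCk n (suc k))) ⟩
  X + (suc n * (n C k) + suc n * (n C suc k))     ≡⟨ cong (X +_) (*-distribˡ-+ (suc n) (n C k) (n C suc k)) ⟨
  X + suc n * (n C k + n C suc k)                 ≡⟨ cong (λ Z → X + suc n * Z) (nCk+nC[k+1]≡[n+1]C[k+1] n k) ⟩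
  X + suc n * X                                   ∎
  where
  open ≡-Reasoning
  X = suc n C suc k
  Y = suc n C suc (suc k)
  regroup : ∀ k X Y → suc (suc k) * (X + Y) ≡ X + (suc k * X + suc (suc k) * Y)
  regroup = solve 3 (λ k X Y → (con 2 :+ k) :* (X :+ Y) := X :+ ((con 1 :+ k) :* X :+ (con 2 :+ k) :* Y)) refl
    where open +-*-Solver

centralBinomial : ℕ → ℕ
centralBinomial m = (2 * m) C m

centralBinomial-suc : ∀ m → suc m * centralBinomial (suc m) ≡ 2 * suc (2 * m) * centralBinomial m
centralBinomial-suc m = begin
  suc m * ((2 * suc m) C suc m)      ≡⟨ cong (λ a → suc m * (a C suc m)) 2[1+m]≡2+2m ⟩
  suc m * (suc (suc N) C suc m)      ≡⟨ [1+k]*[1+n]C[1+k]≡[1+n]*nCk (suc N) m ⟩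
  suc (suc N) * (suc N C m)          ≡⟨ cong (_* (suc N C m)) 2[1+m]≡2+2m ⟨
  2 * suc m * (suc N C m)            ≡⟨ *-assoc 2 (suc m) _ ⟩
  2 * (suc m * (suc N C m))          ≡⟨ cong (λ c → 2 * (suc m * c)) symmetric ⟩
  2 * (suc m * (suc N C suc m))      ≡⟨ cong (2 *_) ([1+k]*[1+n]C[1+k]≡[1+n]*nCk N m) ⟩
  2 * (suc N * (N C m))              ≡⟨ *-assoc 2 (suc N) _ ⟨
  2 * suc N * centralBinomial m      ∎
  where
  open ≡-Reasoning
  N = 2 * m
  2[1+m]≡2+2m : 2 * suc m ≡ suc (suc N)
  2[1+m]≡2+2m = *-suc 2 m
  1+N≡m+[1+m] : suc N ≡ m + suc m
  1+N≡m+[1+m] = trans (cong suc (cong (m +_) (+-identityʳ m))) (sym (+-suc m m))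
  symmetric : suc N C m ≡ suc N C suc m
  symmetric = trans (nCk≡nC[n∸k] (≤-trans (m≤m+n m (suc m)) (≤-reflexive (sym 1+N≡m+[1+m]))))
                    (cong (suc N C_) (trans (cong (_∸ m) 1+N≡m+[1+m]) (m+n∸m≡n m (suc m))))

centralBinomial²-bound : ∀ m → centralBinomial m * centralBinomial m * (3 * m + 1) ≤ 16 ^ m
centralBinomial²-bound zero = ≤-refl
centralBinomial²-bound (suc m) = *-cancelˡ-≤ (a * a) (begin
  a * a * (X′ * X′ * (3 * a + 1))          ≡⟨ regroup₁ a X′ (3 * a + 1) ⟩
  (a * X′) * (a * X′) * (3 * a + 1)        ≡⟨ cong (λ Z → Z * Z * (3 * a + 1)) (centralBinomial-suc m) ⟩
  (c * X) * (c * X) * (3 * a + 1)          ≡⟨ regroup₂ c X (3 * a + 1) ⟩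
  c * c * (3 * a + 1) * (X * X)            ≤⟨ *-monoˡ-≤ (X * X) (≤-trans (m≤m+n (c * c * (3 * a + 1)) (4 * m)) (≤-reflexive (ratio m))) ⟩
  16 * (3 * m + 1) * (a * a) * (X * X)     ≡⟨ regroup₃ (3 * m + 1) (a * a) X ⟩
  a * a * (16 * (X * X * (3 * m + 1)))     ≤⟨ *-monoʳ-≤ (a * a) (*-monoʳ-≤ 16 (centralBinomial²-bound m)) ⟩
  a * a * 16 ^ suc m                       ∎)
  where
  open ≤-Reasoning
  open +-*-Solver
  a = suc m
  X = centralBinomial m
  X′ = centralBinomial (suc m)
  c = 2 * suc (2 * m)
  ratio : ∀ m → 2 * suc (2 * m) * (2 * suc (2 * m)) * (3 * suc m + 1) + 4 * m
              ≡ 16 * (3 * m + 1) * (suc m * suc m)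
  ratio = solve 1 (λ m → con 2 :* (con 1 :+ con 2 :* m) :* (con 2 :* (con 1 :+ con 2 :* m)) :* (con 3 :* (con 1 :+ m) :+ con 1)
                           :+ con 4 :* m
                         := con 16 :* (con 3 :* m :+ con 1) :* ((con 1 :+ m) :* (con 1 :+ m))) refl
  regroup₁ : ∀ a X t → a * a * (X * X * t) ≡ (a * X) * (a * X) * t
  regroup₁ = solve 3 (λ a X t → a :* a :* (X :* X :* t) := (a :* X) :* (a :* X) :* t) refl
  regroup₂ : ∀ c X t → (c * X) * (c * X) * t ≡ c * c * t * (X * X)
  regroup₂ = solve 3 (λ c X t → (c :* X) :* (c :* X) :* t := c :* c :* t :* (X :* X)) refl
  regroup₃ : ∀ p q X → 16 * p * q * (X * X) ≡ q * (16 * (X * X * p))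
  regroup₃ = solve 3 (λ p q X → con 16 :* p :* q :* (X :* X) := q :* (con 16 :* (X :* X :* p))) refl

count≤2*centralBinomial : ∀ m → count m ≤ 2 * centralBinomial m
count≤2*centralBinomial m = ≤-trans (m∸n≤m _ 1) (m∸n≤m _ (m * m))

count²*m≤4*16^m : ∀ m → count m ^ 2 * m ≤ 2 * 2 * 16 ^ m
count²*m≤4*16^m m = begin
  count m * (count m * 1) * m             ≤⟨ *-monoˡ-≤ m (*-mono-≤ (count≤2*centralBinomial m)
                                                                  (*-monoˡ-≤ 1 (count≤2*centralBinomial m))) ⟩
  2 * X * (2 * X * 1) * m                 ≡⟨ regroup X m ⟩
  4 * (X * X * m)                         ≤⟨ *-monoʳ-≤ 4 (*-monoʳ-≤ (X * X) (≤-trans (m≤m+n m (2 * m)) (m≤m+n (3 * m) 1))) ⟩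
  4 * (X * X * (3 * m + 1))               ≤⟨ *-monoʳ-≤ 4 (centralBinomial²-bound m) ⟩
  4 * 16 ^ m                              ∎
  where
  open ≤-Reasoning
  X = centralBinomial m
  regroup : ∀ X m → 2 * X * (2 * X * 1) * m ≡ 4 * (X * X * m)
  regroup = solve 2 (λ X m → con 2 :* X :* (con 2 :* X :* con 1) :* m := con 4 :* (X :* X :* m)) refl
    where open +-*-Solver

lemma5p5 : ((m : ℕ) → 1 ≤ m → HasCard (Counted {m}) (count m))
    × (∃ λ C → (m : ℕ) → 1 ≤ m → count m ^ 2 * m ≤ C * C * 16 ^ m)
lemma5p5 = (λ m 1≤m → counted-HasCard m {{>-nonZero 1≤m}}) , (2 , λ m _ → count²*m≤4*16^m m)
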